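{- Let $k>k'\geq 0$ and $s\geq 1$ be integers and let $\epsilon>0$. Then there exists a constant $n_0=n_0(k,k',s,\epsilon)$ such that the following holds for every $n\geq n_0$: if $G$ is a graph on $n$ vertices with maximum degree $\Delta(G)\leq k-1$ and $e(G)=(k'n+\epsilon n)/2$, then $G$ contains $s\cdot P_{k'+2}$ and $s\cdot S_{k'+2}$ as subgraphs.
   Context: $P_m$ denotes the path on $m$ vertices, $S_m$ the star on $m$ vertices, and $s\cdot H$ the vertex-disjoint union of $s$ copies of the graph $H$. $e(G)$ is the number of edges of $G$. -}

module Defs where

open import Data.Nat using (ℕ; zero; suc; _+_; _≡ᵇ_; _<ᵇ_)
open import Data.Bool using (Bool; true; false; _∧_; _∨_; T; not)
open import Data.Fin using (Fin; toℕ)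
open import Data.List using (List; []; _∷_; map; allFin; concatMap)
open import Data.Product using (Σ; _×_; _,_)
open import Relation.Binary.PropositionalEquality using (_≡_)
open import Function.Definitions using (Injective)

record Graph (V : Set) : Set where
  field adj : V → V → Bool
open Graph public

IsSimple : {V : Set} → Graph V → Set
IsSimple G = (∀ u v → adj G u v ≡ adj G v u) × (∀ u → adj G u u ≡ false)

countTrue : List Bool → ℕ
countTrue [] = 0
countTrue (true ∷ bs) = suc (countTrue bs)
countTrue (false ∷ bs) = countTrue bs

degree : {n : ℕ} → Graph (Fin n) → Fin n → ℕ
degree {n} G v = countTrue (map (adj G v) (allFin n))

edges : {n : ℕ} → Graph (Fin n) → ℕ
edges {n} G =
  countTrue (concatMap (λ i → map (λ j → (toℕ i <ᵇ toℕ j) ∧ adj G i j) (allFin n)) (allFin n))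

Path : (m : ℕ) → Graph (Fin m)
Path m = record { adj = λ i j → (suc (toℕ i) ≡ᵇ toℕ j) ∨ (suc (toℕ j) ≡ᵇ toℕ i) }

Star : (m : ℕ) → Graph (Fin m)
Star m = record { adj = λ i j →
  ((toℕ i ≡ᵇ 0) ∧ not (toℕ j ≡ᵇ 0)) ∨ ((toℕ j ≡ᵇ 0) ∧ not (toℕ i ≡ᵇ 0)) }

_·_ : {V : Set} → (s : ℕ) → Graph V → Graph (Fin s × V)
s · H = record { adj = λ { (a , u) (b , v) → (toℕ a ≡ᵇ toℕ b) ∧ adj H u v } }

Contains : {V W : Set} → Graph W → Graph V → Set
Contains {V} {W} G H =
  Σ (V → W) λ f → Injective _≡_ _≡_ f × (∀ u v → T (adj H u v) → T (adj G (f u) (f v)))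

-- A vertex set S with 2e(G[S]) > k'|S| contains S_{k'+2}, since some degree exceeds k', and
-- P_{k'+2} (Erdős–Gallai). The latter goes by induction on |S|: grow a path at both ends until
-- it has k'+2 vertices or both ends have all their neighbours on it. Then either an end has
-- degree ≤ k'/2 and is deleted, or the two end degrees exceed the length of the path and Ore's
-- crossing argument closes it into a cycle; a vertex outside adjacent to the cycle gives a
-- longer path, and otherwise the cycle spans a component on at most k'+1 vertices, which is
-- split off. Deleting one copy of a (k'+2)-vertex graph lowers 2e by at most 2(k'+2)(k-1), so
-- once n exceeds 2(k'+2)(k-1)sq the surplus εn of 2e(G) over k'n leaves room for s disjoint
-- copies.

module Submission where

open import Defs
open import Data.Bool using (Bool; true; false; _∧_; not; T)
open import Data.Bool.Properties using (∧-zeroʳ; T-∧; T-∨; T-≡)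
open import Data.Empty using (⊥-elim)
open import Data.Fin using (Fin; zero; suc; toℕ; punchIn)
open import Data.Fin.Properties using (_≟_; punchInᵢ≢i; any?)
import Data.Fin.Properties as Fin
open import Data.List using (List; []; _∷_; _++_; [_]; length; lookup)
import Data.List as List
open import Data.List.Properties using (length-tabulate)
open import Data.List.Membership.Propositional using (_∈_; _∉_; find)
open import Data.List.Membership.Propositional.Properties using (∈-∃++; ∈-lookup; ∈-tabulate⁺)
open import Data.List.Relation.Binary.Permutation.Propositional
  using (_↭_; ↭-refl; ↭-prep; ↭-trans; ↭-sym; ↭⇒↭ₛ)
open import Data.List.Relation.Binary.Permutation.Propositional.Properties
  using (++-comm; ++⁺ʳ; ++⁺ˡ; ∈-resp-↭; All-resp-↭; ↭-length)
import Data.List.Relation.Binary.Permutation.Setoid.Properties as PermSetoid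
open import Data.List.Relation.Unary.All using (All; []; _∷_)
import Data.List.Relation.Unary.All as All
open import Data.List.Relation.Unary.All.Properties using (All¬⇒¬Any; ¬Any⇒All¬)
open import Data.List.Relation.Unary.AllPairs using ([]; _∷_)
open import Data.List.Relation.Unary.Any using (here; there)
import Data.List.Relation.Unary.Any as Any
open import Data.List.Relation.Unary.Linked using (Linked; []; [-]; _∷_)
open import Data.List.Relation.Unary.Unique.Propositional using (Unique)
open import Data.Nat using (ℕ; zero; suc; _+_; _*_; _∸_; _≤_; _<_; z≤n; s≤s; _≤?_; _<ᵇ_)
open import Data.Nat.Induction using (<-wellFounded)
import Data.Nat.ListAction as ListAction
open import Data.Nat.Properties hiding (_≟_)
open import Algebra.Properties.Semiring.Sum +-*-semiring
  using (sum; sum-cong-≗; ∑-distrib-+; ∑-comm; sum-replicate-zero; *-distribˡ-sum; sum-remove)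
open import Data.Product using (Σ; _×_; _,_; proj₁; proj₂; ∃-syntax)
open import Data.Sum using (_⊎_; inj₁; inj₂)
open import Function using (_∘_; _on_; id)
open import Function.Bundles using (module Equivalence)
open Equivalence using (to)
open import Function.Definitions using (Injective)
open import Induction.WellFounded using (Acc; acc)
import Relation.Binary.Construct.On as On
open import Relation.Binary.PropositionalEquality hiding ([_])
import Relation.Binary.PropositionalEquality as ≡
open import Relation.Nullary using (¬_; yes; no; does)
open import Relation.Nullary.Decidable using (dec-true; dec-false; T?; _×-dec_; ¬?; decidable-stable)

⟦_⟧ : Bool → ℕ
⟦ true ⟧ = 1
⟦ false ⟧ = 0

⟦⟧≤1 : ∀ b → ⟦ b ⟧ ≤ 1
⟦⟧≤1 true = ≤-refl
⟦⟧≤1 false = z≤n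

⟦∧⟧ : ∀ a b → ⟦ a ∧ b ⟧ ≡ ⟦ a ⟧ * ⟦ b ⟧
⟦∧⟧ true b = sym (+-identityʳ _)
⟦∧⟧ false b = refl

⟦∧⟧≤ʳ : ∀ a b → ⟦ a ∧ b ⟧ ≤ ⟦ b ⟧
⟦∧⟧≤ʳ true b = ≤-refl
⟦∧⟧≤ʳ false b = z≤n

m+m≡2*m : ∀ m → m + m ≡ 2 * m
m+m≡2*m m = cong (m +_) (sym (+-identityʳ m))

summand-≤-half : ∀ a b {k} → a + b ≤ k → 2 * a ≤ k ⊎ 2 * b ≤ k
summand-≤-half a b a+b≤k with ≤-total a b
... | inj₁ a≤b = inj₁ (≤-trans (≤-reflexive (sym (m+m≡2*m a))) (≤-trans (+-monoʳ-≤ a a≤b) a+b≤k))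
... | inj₂ b≤a = inj₂ (≤-trans (≤-reflexive (sym (m+m≡2*m b)))
                               (≤-trans (+-monoʳ-≤ b b≤a) (≤-trans (≤-reflexive (+-comm b a)) a+b≤k)))

⟦⟧-split : ∀ b x → x ≡ ⟦ b ⟧ * x + ⟦ not b ⟧ * x
⟦⟧-split true x = sym (trans (+-identityʳ (1 * x)) (*-identityˡ x))
⟦⟧-split false x = sym (*-identityˡ x)

sum-mono-≤ : ∀ {m} {f g : Fin m → ℕ} → (∀ i → f i ≤ g i) → sum f ≤ sum g
sum-mono-≤ {zero} f≤g = z≤n
sum-mono-≤ {suc m} f≤g = +-mono-≤ (f≤g zero) (sum-mono-≤ (f≤g ∘ suc))

sum-zero : ∀ {m} {f : Fin m → ℕ} → (∀ i → f i ≡ 0) → sum f ≡ 0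
sum-zero {m} f≡0 = trans (sum-cong-≗ f≡0) (sum-replicate-zero m)

sum-point : ∀ {m} (f : Fin m → ℕ) x → (∀ i → i ≢ x → f i ≡ 0) → sum f ≡ f x
sum-point {suc m} f x f≡0 = begin
  sum f                                   ≡⟨ sum-remove f ⟩
  f x + sum (λ j → f (punchIn x j))
    ≡⟨ cong (f x +_) (sum-zero (λ j → f≡0 _ (punchInᵢ≢i x j))) ⟩
  f x + 0                                 ≡⟨ +-identityʳ (f x) ⟩
  f x                                     ∎
  where open ≡-Reasoning

term≤sum : ∀ {m} (f : Fin m → ℕ) i → f i ≤ sum f
term≤sum {suc m} f i = ≤-trans (m≤m+n (f i) _) (≤-reflexive (sym (sum-remove {i = i} f)))

sum-ones : ∀ m → sum {m} (λ _ → 1) ≡ m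
sum-ones zero = refl
sum-ones (suc m) = cong suc (sum-ones m)

choose : ∀ {N} (p : Fin N → Bool) m → m ≤ sum (λ v → ⟦ p v ⟧) →
         Σ (Fin m → Fin N) λ g → Injective _≡_ _≡_ g × (∀ i → T (p (g i)))
choose p zero _ = (λ ()) , (λ { {()} }) , (λ ())
choose {suc N} p (suc m) m<∑ with p zero in p0
... | true with choose (p ∘ suc) m (≤-pred m<∑)
...   | g , g-inj , pg = g′ , g′-inj , pg′
  where
  g′ : Fin (suc m) → Fin (suc N)
  g′ zero = zero
  g′ (suc i) = suc (g i)
  g′-inj : Injective _≡_ _≡_ g′
  g′-inj {zero} {zero} _ = refl
  g′-inj {suc i} {suc j} eq = cong suc (g-inj (Fin.suc-injective eq))
  pg′ : ∀ i → T (p (g′ i))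
  pg′ zero rewrite p0 = _
  pg′ (suc i) = pg i
choose {suc N} p (suc m) m<∑ | false with choose (p ∘ suc) (suc m) m<∑
... | g , g-inj , pg = suc ∘ g , g-inj ∘ Fin.suc-injective , pg

module _ {A : Set} where

  lastOf : A → List A → A
  lastOf x [] = x
  lastOf x (y ∷ ys) = lastOf y ys

  lastOf-++ : ∀ x xs y ys → lastOf x (xs ++ y ∷ ys) ≡ lastOf y ys
  lastOf-++ x [] y ys = refl
  lastOf-++ x (x′ ∷ xs) y ys = lastOf-++ x′ xs y ys

  lastOf-∈ : ∀ x xs → lastOf x xs ∈ x ∷ xs
  lastOf-∈ x [] = here refl
  lastOf-∈ x (y ∷ ys) = there (lastOf-∈ y ys)

  -- reverse (x ∷ xs) is lastOf x xs ∷ reverseTail x xs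
  reverseTail : A → List A → List A
  reverseTail x [] = []
  reverseTail x (y ∷ ys) = reverseTail y ys ++ [ x ]

  lastOf-reverseTail : ∀ x xs → lastOf (lastOf x xs) (reverseTail x xs) ≡ x
  lastOf-reverseTail x [] = refl
  lastOf-reverseTail x (y ∷ ys) = lastOf-++ (lastOf y ys) (reverseTail y ys) x []

  ↭-reverseTail : ∀ x xs → x ∷ xs ↭ lastOf x xs ∷ reverseTail x xs
  ↭-reverseTail x [] = ↭-refl
  ↭-reverseTail x (y ∷ ys) = ↭-trans (++-comm [ x ] (y ∷ ys)) (++⁺ʳ [ x ] (↭-reverseTail y ys))

  Unique-resp-↭ : ∀ {xs ys : List A} → xs ↭ ys → Unique xs → Unique ys
  Unique-resp-↭ p = PermSetoid.Unique-resp-↭ (≡.setoid A) (↭⇒↭ₛ p)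

  module _ {R : A → A → Set} where

    Linked-split : ∀ x xs y ys → Linked R (x ∷ xs ++ y ∷ ys) →
                   Linked R (x ∷ xs) × R (lastOf x xs) y × Linked R (y ∷ ys)
    Linked-split x [] y ys (r ∷ l) = [-] , r , l
    Linked-split x (x′ ∷ xs) y ys (r ∷ l) with Linked-split x′ xs y ys l
    ... | l₁ , r′ , l₂ = r ∷ l₁ , r′ , l₂

    Linked-join : ∀ x xs y ys → Linked R (x ∷ xs) → R (lastOf x xs) y → Linked R (y ∷ ys) →
                  Linked R (x ∷ xs ++ y ∷ ys)
    Linked-join x [] y ys [-] r l = r ∷ l
    Linked-join x (x′ ∷ xs) y ys (r ∷ l₁) r′ l₂ = r ∷ Linked-join x′ xs y ys l₁ r′ l₂

    Linked-reverse : (∀ {u v} → R u v → R v u) → ∀ x xs → Linked R (x ∷ xs) →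
                     Linked R (lastOf x xs ∷ reverseTail x xs)
    Linked-reverse R-sym x [] l = [-]
    Linked-reverse R-sym x (y ∷ ys) (r ∷ l) =
      Linked-join (lastOf y ys) (reverseTail y ys) x []
        (Linked-reverse R-sym y ys l)
        (subst (λ w → R w x) (sym (lastOf-reverseTail y ys)) (R-sym r))
        [-]

    Linked-rotate : ∀ x xs → Linked R (x ∷ xs) → R (lastOf x xs) x → ∀ {z} → z ∈ x ∷ xs →
                    Σ (List A) λ zs → Linked R (z ∷ zs) × z ∷ zs ↭ x ∷ xs
    Linked-rotate x xs l r (here refl) = xs , l , ↭-refl
    Linked-rotate x xs l r {z} (there z∈xs) with ∈-∃++ z∈xs
    ... | ys , zs , refl with Linked-split x ys z zs l
    ...   | l₁ , r′ , l₂ =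
      zs ++ x ∷ ys ,
      Linked-join z zs x ys l₂ (subst (λ w → R w x) (lastOf-++ x ys z zs) r) l₁ ,
      ++-comm (z ∷ zs) (x ∷ ys)

  lookup-injective : ∀ {xs : List A} → Unique xs → ∀ {i j} → lookup xs i ≡ lookup xs j → i ≡ j
  lookup-injective {x ∷ xs} _ {zero} {zero} _ = refl
  lookup-injective {x ∷ xs} (x∉xs ∷ _) {zero} {suc j} x≡ =
    ⊥-elim (All¬⇒¬Any x∉xs (subst (_∈ xs) (sym x≡) (∈-lookup j)))
  lookup-injective {x ∷ xs} (x∉xs ∷ _) {suc i} {zero} ≡x =
    ⊥-elim (All¬⇒¬Any x∉xs (subst (_∈ xs) ≡x (∈-lookup i)))
  lookup-injective {x ∷ xs} (_ ∷ u) {suc i} {suc j} eq = cong suc (lookup-injective u eq)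

  Linked-lookup : ∀ {R : A → A → Set} {xs} → Linked R xs →
                  ∀ i j → suc (toℕ i) ≡ toℕ j → R (lookup xs i) (lookup xs j)
  Linked-lookup (r ∷ _) zero (suc zero) _ = r
  Linked-lookup (_ ∷ l) (suc i) (suc j) eq = Linked-lookup l i j (suc-injective eq)

sumOver : {A : Set} → List A → (A → ℕ) → ℕ
sumOver xs f = ListAction.sum (List.map f xs)

sumOver-mono : {A : Set} (xs : List A) {f g : A → ℕ} → (∀ x → f x ≤ g x) → sumOver xs f ≤ sumOver xs g
sumOver-mono [] f≤g = z≤n
sumOver-mono (x ∷ xs) f≤g = +-mono-≤ (f≤g x) (sumOver-mono xs f≤g)

sumOver-≤ : {A : Set} (xs : List A) {f : A → ℕ} {c : ℕ} → (∀ x → f x ≤ c) →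
            sumOver xs f ≤ length xs * c
sumOver-≤ [] f≤c = z≤n
sumOver-≤ (x ∷ xs) f≤c = +-mono-≤ (f≤c x) (sumOver-≤ xs f≤c)

sumOver-<-length : {A : Set} (xs : List A) {f : A → ℕ} → (∀ x → f x ≤ 1) →
                   ∀ {z} → z ∈ xs → f z ≡ 0 → sumOver xs f < length xs
sumOver-<-length (x ∷ xs) {f} f≤1 (here refl) fz≡0 =
  s≤s (subst (_≤ length xs) (sym (cong (_+ sumOver xs f) fz≡0))
             (≤-trans (sumOver-≤ xs f≤1) (≤-reflexive (*-identityʳ _))))
sumOver-<-length (x ∷ xs) {f} f≤1 (there z∈xs) fz≡0 =
  ≤-trans (≤-reflexive (sym (+-suc (f x) _))) (+-mono-≤ (f≤1 x) (sumOver-<-length xs f≤1 z∈xs fz≡0))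

sum-supported : ∀ {m} (f : Fin m → ℕ) (ys : List (Fin m)) → (∀ v → v ∉ ys → f v ≡ 0) →
                sum f ≤ sumOver ys f
sum-supported f [] outside≡0 = ≤-reflexive (sum-zero (λ v → outside≡0 v (λ ())))
sum-supported f (y ∷ ys) outside≡0 = begin
  sum f                       ≡⟨ sum-cong-≗ split ⟩
  sum (λ v → at-y v + off-y v) ≡⟨ ∑-distrib-+ at-y off-y ⟩
  sum at-y + sum off-y        ≤⟨ +-mono-≤ (≤-reflexive (trans (sum-point at-y y at-y≡0) at-y-y))
                                          (sum-supported off-y ys off-y≡0) ⟩
  f y + sumOver ys off-y      ≤⟨ +-monoʳ-≤ (f y) (sumOver-mono ys off-y≤f) ⟩
  f y + sumOver ys f          ∎
  where
  open ≤-Reasoning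
  at-y off-y : _ → ℕ
  at-y v = ⟦ does (v ≟ y) ⟧ * f v
  off-y v = ⟦ not (does (v ≟ y)) ⟧ * f v
  split : ∀ v → f v ≡ at-y v + off-y v
  split v = ⟦⟧-split (does (v ≟ y)) (f v)
  at-y-y : at-y y ≡ f y
  at-y-y rewrite dec-true (y ≟ y) refl = +-identityʳ (f y)
  at-y≡0 : ∀ v → v ≢ y → at-y v ≡ 0
  at-y≡0 v v≢y with v ≟ y
  ... | yes v≡y = ⊥-elim (v≢y v≡y)
  ... | no _ = refl
  off-y≡0 : ∀ v → v ∉ ys → off-y v ≡ 0
  off-y≡0 v v∉ys with v ≟ y
  ... | yes _ = refl
  ... | no v≢y = trans (+-identityʳ (f v))
                       (outside≡0 v λ { (here v≡y) → v≢y v≡y ; (there v∈ys) → v∉ys v∈ys })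
  off-y≤f : ∀ v → off-y v ≤ f v
  off-y≤f v = ≤-trans (*-monoˡ-≤ (f v) (⟦⟧≤1 (not (does (v ≟ y))))) (≤-reflexive (*-identityˡ (f v)))

countTrue-++ : ∀ xs ys → countTrue (xs ++ ys) ≡ countTrue xs + countTrue ys
countTrue-++ [] ys = refl
countTrue-++ (true ∷ xs) ys = cong suc (countTrue-++ xs ys)
countTrue-++ (false ∷ xs) ys = countTrue-++ xs ys

countTrue-map-tabulate : ∀ {m} {A : Set} (f : A → Bool) (g : Fin m → A) →
                         countTrue (List.map f (List.tabulate g)) ≡ sum (λ i → ⟦ f (g i) ⟧)
countTrue-map-tabulate {zero} f g = refl
countTrue-map-tabulate {suc m} f g with f (g zero)
... | true = cong suc (countTrue-map-tabulate f (g ∘ suc))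
... | false = countTrue-map-tabulate f (g ∘ suc)

countTrue-concatMap-tabulate : ∀ {m} {A : Set} (f : A → List Bool) (g : Fin m → A) →
                               countTrue (List.concatMap f (List.tabulate g)) ≡ sum (λ i → countTrue (f (g i)))
countTrue-concatMap-tabulate {zero} f g = refl
countTrue-concatMap-tabulate {suc m} f g =
  trans (countTrue-++ (f (g zero)) _) (cong (countTrue (f (g zero)) +_) (countTrue-concatMap-tabulate f (g ∘ suc)))

<ᵇ-∧-antisym : ∀ x y b → ⟦ (x <ᵇ y) ∧ b ⟧ + ⟦ (y <ᵇ x) ∧ b ⟧ ≤ ⟦ b ⟧
<ᵇ-∧-antisym x y b with x <ᵇ y in x<y | y <ᵇ x in y<x | b
... | true | true | _ = ⊥-elim (<-asym (<ᵇ⇒< x y (subst T (sym x<y) _)) (<ᵇ⇒< y x (subst T (sym y<x) _)))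
... | true | false | true = ≤-refl
... | false | true | true = ≤-refl
... | false | false | true = z≤n
... | true | false | false = z≤n
... | false | true | false = z≤n
... | false | false | false = z≤n

module InducedSubgraphs {n : ℕ} (G : Graph (Fin n)) (simple : IsSimple G) where

  infix 4 _~_
  _~_ : Fin n → Fin n → Set
  u ~ v = T (adj G u v)

  ~-sym : ∀ {u v} → u ~ v → v ~ u
  ~-sym {u} {v} = subst T (proj₁ simple u v)

  ~-irrefl : ∀ u → ¬ u ~ u
  ~-irrefl u = subst T (proj₂ simple u)

  VertexSet : Set
  VertexSet = Fin n → Bool

  infixl 6 _∩_ _∖_ _─_
  infix 4 _⊆_

  _∩_ _∖_ : VertexSet → VertexSet → VertexSet
  (S ∩ P) v = S v ∧ P v
  (S ∖ P) v = S v ∧ not (P v)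

  ｛_｝ : Fin n → VertexSet
  ｛ x ｝ v = does (v ≟ x)

  ∈｛｝⇒≡ : ∀ {v x : Fin n} → T (does (v ≟ x)) → v ≡ x
  ∈｛｝⇒≡ {v} {x} _ with v ≟ x
  ... | yes v≡x = v≡x

  _─_ : VertexSet → Fin n → VertexSet
  S ─ x = S ∖ ｛ x ｝

  _⊆_ : VertexSet → VertexSet → Set
  S ⊆ S′ = ∀ v → T (S v) → T (S′ v)

  size : VertexSet → ℕ
  size S = sum λ v → ⟦ S v ⟧

  deg : VertexSet → Fin n → ℕ
  deg S x = sum λ v → ⟦ S v ∧ adj G x v ⟧

  -- twice the number of edges of G[S]
  degreeSum : VertexSet → ℕ
  degreeSum S = sum λ u → sum λ v → ⟦ S u ∧ (S v ∧ adj G u v) ⟧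

  degreeSumOn : VertexSet → VertexSet → ℕ
  degreeSumOn S P = sum λ u → ⟦ (S ∩ P) u ⟧ * deg S u

  degreeSum≡∑deg : ∀ S → degreeSum S ≡ sum λ u → ⟦ S u ⟧ * deg S u
  degreeSum≡∑deg S = sum-cong-≗ λ u → begin
    sum (λ v → ⟦ S u ∧ (S v ∧ adj G u v) ⟧)   ≡⟨ sum-cong-≗ (λ v → ⟦∧⟧ (S u) (S v ∧ adj G u v)) ⟩
    sum (λ v → ⟦ S u ⟧ * ⟦ S v ∧ adj G u v ⟧) ≡⟨ *-distribˡ-sum ⟦ S u ⟧ (λ v → ⟦ S v ∧ adj G u v ⟧) ⟨
    ⟦ S u ⟧ * deg S u                          ∎
    where open ≡-Reasoning

  degreeSum-≤ : ∀ S {d} → (∀ u → T (S u) → deg S u ≤ d) → degreeSum S ≤ d * size S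
  degreeSum-≤ S {d} deg≤d = begin
    degreeSum S                     ≡⟨ degreeSum≡∑deg S ⟩
    sum (λ u → ⟦ S u ⟧ * deg S u)   ≤⟨ sum-mono-≤ bound ⟩
    sum (λ u → d * ⟦ S u ⟧)         ≡⟨ *-distribˡ-sum d (λ u → ⟦ S u ⟧) ⟨
    d * size S                      ∎
    where
    open ≤-Reasoning
    bound : ∀ u → ⟦ S u ⟧ * deg S u ≤ d * ⟦ S u ⟧
    bound u with S u in Su
    ... | true = ≤-trans (≤-reflexive (+-identityʳ _))
                         (≤-trans (deg≤d u (subst T (sym Su) _)) (≤-reflexive (sym (*-identityʳ d))))
    ... | false = z≤n

  size-split : ∀ S P → size S ≡ size (S ∩ P) + size (S ∖ P)
  size-split S P = trans (sum-cong-≗ λ v → pointwise (S v) (P v))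
                         (∑-distrib-+ (λ v → ⟦ (S ∩ P) v ⟧) (λ v → ⟦ (S ∖ P) v ⟧))
    where
    pointwise : ∀ s p → ⟦ s ⟧ ≡ ⟦ s ∧ p ⟧ + ⟦ s ∧ not p ⟧
    pointwise true true = refl
    pointwise true false = refl
    pointwise false p = refl

  size-∖-≤ : ∀ S P → size (S ∖ P) ≤ size S
  size-∖-≤ S P = ≤-trans (m≤n+m _ _) (≤-reflexive (sym (size-split S P)))

  size-─ : ∀ S x → T (S x) → size S ≡ suc (size (S ─ x))
  size-─ S x x∈S = trans (size-split S ｛ x ｝) (cong (_+ size (S ─ x)) size-｛x｝)
    where
    size-｛x｝ : size (S ∩ ｛ x ｝) ≡ 1
    size-｛x｝ = begin
      size (S ∩ ｛ x ｝)          ≡⟨ sum-point (λ v → ⟦ (S ∩ ｛ x ｝) v ⟧) x outside ⟩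
      ⟦ S x ∧ does (x ≟ x) ⟧      ≡⟨ cong₂ (λ s e → ⟦ s ∧ e ⟧) (to T-≡ x∈S) (dec-true (x ≟ x) refl) ⟩
      1                           ∎
      where
      open ≡-Reasoning
      outside : ∀ v → v ≢ x → ⟦ S v ∧ does (v ≟ x) ⟧ ≡ 0
      outside v v≢x rewrite dec-false (v ≟ x) v≢x = cong ⟦_⟧ (∧-zeroʳ (S v))

  degreeSum-∖ : ∀ S P → degreeSum S ≤ degreeSum (S ∖ P) + 2 * degreeSumOn S P
  degreeSum-∖ S P = begin
    degreeSum S
      ≤⟨ sum-mono-≤ (λ u → sum-mono-≤ (λ v → pointwise u v)) ⟩
    sum (λ u → sum (λ v → kept u v + fromU u v + fromV u v))
      ≡⟨ sum-cong-≗ (λ u → trans (∑-distrib-+ (λ v → kept u v + fromU u v) (fromV u))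
                                   (cong (_+ sum (fromV u)) (∑-distrib-+ (kept u) (fromU u)))) ⟩
    sum (λ u → sum (kept u) + sum (fromU u) + sum (fromV u))
      ≡⟨ trans (∑-distrib-+ (λ u → sum (kept u) + sum (fromU u)) (λ u → sum (fromV u)))
               (cong (_+ sum (λ u → sum (fromV u)))
                     (∑-distrib-+ (λ u → sum (kept u)) (λ u → sum (fromU u)))) ⟩
    degreeSum (S ∖ P) + sum (λ u → sum (fromU u)) + sum (λ u → sum (fromV u))
      ≡⟨ cong₂ (λ a b → degreeSum (S ∖ P) + a + b) ∑fromU (trans (∑-comm fromV) ∑fromU) ⟩
    degreeSum (S ∖ P) + degreeSumOn S P + degreeSumOn S P
      ≡⟨ trans (+-assoc (degreeSum (S ∖ P)) _ _) (cong (degreeSum (S ∖ P) +_) (m+m≡2*m (degreeSumOn S P))) ⟩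
    degreeSum (S ∖ P) + 2 * degreeSumOn S P
      ∎
    where
    open ≤-Reasoning
    kept fromU fromV : Fin n → Fin n → ℕ
    kept u v = ⟦ (S ∖ P) u ∧ ((S ∖ P) v ∧ adj G u v) ⟧
    fromU u v = ⟦ (S ∩ P) u ⟧ * ⟦ S v ∧ adj G u v ⟧
    fromV u v = ⟦ (S ∩ P) v ⟧ * ⟦ S u ∧ adj G v u ⟧
    ∑fromU : sum (λ u → sum (fromU u)) ≡ degreeSumOn S P
    ∑fromU = sum-cong-≗ λ u → sym (*-distribˡ-sum ⟦ (S ∩ P) u ⟧ (λ v → ⟦ S v ∧ adj G u v ⟧))
    -- an edge of G[S] lies in G[S ∖ P] or has an end in P
    cases : ∀ su sv pu pv a → ⟦ su ∧ (sv ∧ a) ⟧ ≤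
      ⟦ (su ∧ not pu) ∧ ((sv ∧ not pv) ∧ a) ⟧ + ⟦ su ∧ pu ⟧ * ⟦ sv ∧ a ⟧ + ⟦ sv ∧ pv ⟧ * ⟦ su ∧ a ⟧
    cases false sv pu pv a = z≤n
    cases true false pu pv a = z≤n
    cases true true pu pv false = z≤n
    cases true true false false true = s≤s z≤n
    cases true true false true true = s≤s z≤n
    cases true true true pv true = s≤s z≤n
    pointwise : ∀ u v → ⟦ S u ∧ (S v ∧ adj G u v) ⟧ ≤ kept u v + fromU u v + fromV u v
    pointwise u v rewrite proj₁ simple v u = cases (S u) (S v) (P u) (P v) (adj G u v)

  degreeSumOn-≤ : ∀ S P (ys : List (Fin n)) → (∀ v → T (P v) → v ∈ ys) →
                  degreeSumOn S P ≤ sumOver ys (deg S)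
  degreeSumOn-≤ S P ys P⊆ys = ≤-trans (sum-supported _ ys outside) (sumOver-mono ys weight≤1)
    where
    outside : ∀ v → v ∉ ys → ⟦ (S ∩ P) v ⟧ * deg S v ≡ 0
    outside v v∉ys with S v | P v in Pv
    ... | false | _ = refl
    ... | true | false = refl
    ... | true | true = ⊥-elim (v∉ys (P⊆ys v (subst T (sym Pv) _)))
    weight≤1 : ∀ v → ⟦ (S ∩ P) v ⟧ * deg S v ≤ deg S v
    weight≤1 v = ≤-trans (*-monoˡ-≤ (deg S v) (⟦⟧≤1 ((S ∩ P) v))) (≤-reflexive (*-identityˡ _))

  degreeSum-─ : ∀ S x → degreeSum S ≤ degreeSum (S ─ x) + 2 * deg S x
  degreeSum-─ S x = ≤-trans (degreeSum-∖ S ｛ x ｝)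
    (+-monoʳ-≤ (degreeSum (S ─ x)) (*-monoʳ-≤ 2
      (≤-trans (degreeSumOn-≤ S ｛ x ｝ [ x ] (λ v v∈｛x｝ → here (∈｛｝⇒≡ v∈｛x｝)))
               (≤-reflexive (+-identityʳ (deg S x))))))

  Separated : VertexSet → VertexSet → Set
  Separated S P = ∀ u v → T ((S ∩ P) u) → T ((S ∖ P) v) → ¬ u ~ v

  degreeSum-separated : ∀ S P → Separated S P → degreeSum S ≡ degreeSum (S ∩ P) + degreeSum (S ∖ P)
  degreeSum-separated S P sep = begin
    degreeSum S
      ≡⟨ sum-cong-≗ (λ u → sum-cong-≗ (λ v →
           cases (S u) (S v) (P u) (P v) (adj G u v) (sep u v)
                 (λ u∈ v∈ u~v → sep v u v∈ u∈ (~-sym u~v)))) ⟩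
    sum (λ u → sum (λ v → inside u v + outside u v))
      ≡⟨ sum-cong-≗ (λ u → ∑-distrib-+ (inside u) (outside u)) ⟩
    sum (λ u → sum (inside u) + sum (outside u))
      ≡⟨ ∑-distrib-+ (λ u → sum (inside u)) (λ u → sum (outside u)) ⟩
    degreeSum (S ∩ P) + degreeSum (S ∖ P)
      ∎
    where
    open ≡-Reasoning
    inside outside : Fin n → Fin n → ℕ
    inside u v = ⟦ (S ∩ P) u ∧ ((S ∩ P) v ∧ adj G u v) ⟧
    outside u v = ⟦ (S ∖ P) u ∧ ((S ∖ P) v ∧ adj G u v) ⟧
    cases : ∀ su sv pu pv a →
      (T (su ∧ pu) → T (sv ∧ not pv) → ¬ T a) → (T (su ∧ not pu) → T (sv ∧ pv) → ¬ T a) →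
      ⟦ su ∧ (sv ∧ a) ⟧ ≡ ⟦ (su ∧ pu) ∧ ((sv ∧ pv) ∧ a) ⟧ + ⟦ (su ∧ not pu) ∧ ((sv ∧ not pv) ∧ a) ⟧
    cases false sv pu pv a _ _ = refl
    cases true false true pv a _ _ = refl
    cases true false false pv a _ _ = refl
    cases true true true true a _ _ = sym (+-identityʳ _)
    cases true true false false a _ _ = refl
    cases true true true false false _ _ = refl
    cases true true false true false _ _ = refl
    cases true true true false true no-edge _ = ⊥-elim (no-edge _ _ _)
    cases true true false true true _ no-edge = ⊥-elim (no-edge _ _ _)

  open import Data.List.Membership.DecPropositional (_≟_ {n}) using (_∈?_)

  ⟨_⟩ : List (Fin n) → VertexSet
  ⟨ ys ⟩ v = does (v ∈? ys)

  ∈⟨⟩⇒∈ : ∀ {v ys} → T (⟨ ys ⟩ v) → v ∈ ys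
  ∈⟨⟩⇒∈ {v} {ys} t with v ∈? ys
  ... | yes v∈ys = v∈ys

  ∈⇒∈⟨⟩ : ∀ {v ys} → v ∈ ys → T (⟨ ys ⟩ v)
  ∈⇒∈⟨⟩ {v} {ys} v∈ys with v ∈? ys
  ... | yes _ = _
  ... | no v∉ys = v∉ys v∈ys

  ∉⟨⟩⇒∉ : ∀ {v ys} → T (not (⟨ ys ⟩ v)) → v ∉ ys
  ∉⟨⟩⇒∉ {v} {ys} t with v ∈? ys
  ... | no v∉ys = v∉ys

  degIn : Fin n → List (Fin n) → ℕ
  degIn x ys = sumOver ys λ v → ⟦ adj G x v ⟧

  NeighboursIn : VertexSet → Fin n → List (Fin n) → Set
  NeighboursIn S x ys = ∀ w → T (S w) → x ~ w → w ∈ ys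

  deg≤degIn : ∀ S x ys → NeighboursIn S x ys → deg S x ≤ degIn x ys
  deg≤degIn S x ys nbrs = ≤-trans (sum-supported _ ys outside) (sumOver-mono ys (λ v → ⟦∧⟧≤ʳ (S v) _))
    where
    outside : ∀ v → v ∉ ys → ⟦ S v ∧ adj G x v ⟧ ≡ 0
    outside v v∉ys with S v in Sv | adj G x v in x~v
    ... | false | _ = refl
    ... | true | false = refl
    ... | true | true = ⊥-elim (v∉ys (nbrs v (subst T (sym Sv) _) (subst T (sym x~v) _)))

  degIn-∷-self : ∀ x xs → degIn x (x ∷ xs) ≡ degIn x xs
  degIn-∷-self x xs = cong (λ b → ⟦ b ⟧ + degIn x xs) (proj₂ simple x)

  CrossingPair : Fin n → Fin n → List (Fin n) → Set
  CrossingPair a h xs = Σ (List (Fin n)) λ ys → Σ (Fin n) λ y → Σ (List (Fin n)) λ zs →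
    xs ≡ ys ++ y ∷ zs × a ~ y × lastOf h xs ~ lastOf h ys

  CrossingPair-∷ : ∀ {a h y ys} → CrossingPair a y ys → CrossingPair a h (y ∷ ys)
  CrossingPair-∷ {y = y} (zs , z , ws , eq , a~z , e~) = y ∷ zs , z , ws , cong (y ∷_) eq , a~z , e~

  -- Ore's counting: along the path x₀ = h, x₁ … x_ℓ the ℓ pairs (a ~ x_{i+1}, x_ℓ ~ x_i) cannot all miss.
  crossing-pair : ∀ a h xs → length xs < degIn a xs + degIn (lastOf h xs) (h ∷ xs) → CrossingPair a h xs
  crossing-pair a h [] lt rewrite proj₂ simple h with lt
  ... | ()
  crossing-pair a h (y ∷ ys) lt with adj G a y in a~y | adj G (lastOf y ys) h in e~h
  ... | true | true = [] , y , ys , refl , subst T (sym a~y) _ , subst T (sym e~h) _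
  ... | true | false = CrossingPair-∷ (crossing-pair a y ys (≤-pred lt))
  ... | false | true = CrossingPair-∷ (crossing-pair a y ys (≤-pred (≤-trans lt (≤-reflexive (+-suc _ _)))))
  ... | false | false = CrossingPair-∷ (crossing-pair a y ys (<⇒≤ lt))


  closeIntoCycle : ∀ a xs → Linked _~_ (a ∷ xs) → length xs < degIn a xs + degIn (lastOf a xs) (a ∷ xs) →
    Σ (List (Fin n)) λ cs → Linked _~_ (a ∷ cs) × lastOf a cs ~ a × a ∷ cs ↭ a ∷ xs
  closeIntoCycle a xs l lt with crossing-pair a a xs lt
  ... | ys , y , zs , refl , a~y , e~ = cycle , linked , closing , same
    where
    cycle = ys ++ lastOf y zs ∷ reverseTail y zs
    pieces = Linked-split a ys y zs l
    linked : Linked _~_ (a ∷ cycle)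
    linked = Linked-join a ys (lastOf y zs) (reverseTail y zs) (proj₁ pieces)
               (~-sym (subst (_~ lastOf a ys) (lastOf-++ a ys y zs) e~))
               (Linked-reverse ~-sym y zs (proj₂ (proj₂ pieces)))
    closing : lastOf a cycle ~ a
    closing = subst (_~ a)
                (sym (trans (lastOf-++ a ys (lastOf y zs) (reverseTail y zs)) (lastOf-reverseTail y zs)))
                (~-sym a~y)
    same : a ∷ cycle ↭ a ∷ ys ++ y ∷ zs
    same = ↭-prep a (++⁺ˡ ys (↭-sym (↭-reverseTail y zs)))

  spanningPathFrom : ∀ a xs → Linked _~_ (a ∷ xs) → length xs < degIn a xs + degIn (lastOf a xs) (a ∷ xs) →
    ∀ {z} → z ∈ a ∷ xs → Σ (List (Fin n)) λ zs → Linked _~_ (z ∷ zs) × z ∷ zs ↭ a ∷ xs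
  spanningPathFrom a xs l lt z∈ with closeIntoCycle a xs l lt
  ... | cs , linked , closing , same with Linked-rotate a cs linked closing (∈-resp-↭ (↭-sym same) z∈)
  ...   | zs , l′ , perm = zs , l′ , ↭-trans perm same

  record PathIn (S : VertexSet) : Set where
    constructor path
    field
      start : Fin n
      rest : List (Fin n)
      linked : Linked _~_ (start ∷ rest)
      distinct : Unique (start ∷ rest)
      inside : All (λ v → T (S v)) (start ∷ rest)

    vertices : List (Fin n)
    vertices = start ∷ rest

    end : Fin n
    end = lastOf start rest

  open PathIn

  PathIn-⊆ : ∀ {S S′} → S ⊆ S′ → PathIn S → PathIn S′
  PathIn-⊆ S⊆S′ (path x xs l u i) = path x xs l u (All.map (S⊆S′ _) i)

  reversePath : ∀ {S} → PathIn S → PathIn S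
  reversePath (path x xs l u i) =
    path (lastOf x xs) (reverseTail x xs) (Linked-reverse ~-sym x xs l)
         (Unique-resp-↭ (↭-reverseTail x xs) u) (All-resp-↭ (↭-reverseTail x xs) i)

  vertices-reversePath : ∀ {S} (p : PathIn S) → vertices (reversePath p) ↭ vertices p
  vertices-reversePath (path x xs _ _ _) = ↭-sym (↭-reverseTail x xs)

  length-reversePath : ∀ {S} (p : PathIn S) → length (rest (reversePath p)) ≡ length (rest p)
  length-reversePath p = suc-injective (↭-length (vertices-reversePath p))

  Longer : ∀ {S} → PathIn S → Set
  Longer {S} p = Σ (PathIn S) λ p′ → length (rest p′) ≡ suc (length (rest p))

  extend-or-closed : ∀ {S} (p : PathIn S) → Longer p ⊎ NeighboursIn S (start p) (vertices p)
  extend-or-closed {S} (path x xs l u i)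
    with any? (λ w → T? (S w) ×-dec T? (adj G x w) ×-dec ¬? (w ∈? x ∷ xs))
  ... | yes (w , w∈S , x~w , w∉p) =
    inj₁ (path w (x ∷ xs) (~-sym x~w ∷ l) (¬Any⇒All¬ _ w∉p ∷ u) (w∈S ∷ i) , refl)
  ... | no none =
    inj₂ λ w w∈S x~w → decidable-stable (w ∈? x ∷ xs) (λ w∉p → none (w , w∈S , x~w , w∉p))

  ore-bound : ∀ {S} (p : PathIn S) →
              NeighboursIn S (start p) (vertices p) → NeighboursIn S (end p) (vertices p) →
              deg S (start p) + deg S (end p) ≤ degIn (start p) (rest p) + degIn (end p) (vertices p)
  ore-bound {S} p start-closed end-closed =
    +-mono-≤ (≤-trans (deg≤degIn S (start p) (vertices p) start-closed)
                      (≤-reflexive (degIn-∷-self (start p) (rest p))))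
             (deg≤degIn S (end p) (vertices p) end-closed)

  extend-via-cycle : ∀ {S} (p : PathIn S) →
                     length (rest p) < degIn (start p) (rest p) + degIn (end p) (vertices p) →
                     ∀ {w z} → T (S w) → w ∉ vertices p → z ∈ vertices p → z ~ w → Longer p
  extend-via-cycle p long-enough {w} {z} w∈S w∉p z∈p z~w
    with spanningPathFrom (start p) (rest p) (linked p) long-enough z∈p
  ... | zs , l , perm =
    path w (z ∷ zs) (~-sym z~w ∷ l)
      (¬Any⇒All¬ _ (w∉p ∘ ∈-resp-↭ perm) ∷ Unique-resp-↭ (↭-sym perm) (distinct p))
      (w∈S ∷ All-resp-↭ (↭-sym perm) (inside p)) ,
    ↭-length perm

  record CopyIn {W : Set} (S : VertexSet) (H : Graph W) : Set where
    constructor copy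
    field
      embed : W → Fin n
      injective : Injective _≡_ _≡_ embed
      edges-preserved : ∀ u v → T (adj H u v) → embed u ~ embed v
      within : ∀ u → T (S (embed u))

  path⇒copy : ∀ {S} (p : PathIn S) → CopyIn S (Path (length (vertices p)))
  path⇒copy p = copy (lookup (vertices p)) (lookup-injective (distinct p)) consecutive
                     (λ i → All.lookup (inside p) (∈-lookup i))
    where
    consecutive : ∀ i j → T (adj (Path _) i j) → lookup (vertices p) i ~ lookup (vertices p) j
    consecutive i j i~j with to T-∨ i~j
    ... | inj₁ i→j = Linked-lookup (linked p) i j (≡ᵇ⇒≡ _ _ i→j)
    ... | inj₂ j→i = ~-sym (Linked-lookup (linked p) j i (≡ᵇ⇒≡ _ _ j→i))

  ∖-⊆ : ∀ S P → S ∖ P ⊆ S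
  ∖-⊆ S P v v∈ = proj₁ (to T-∧ v∈)

  size-∖-< : ∀ S P {x} → T (S x) → T (P x) → size (S ∖ P) < size S
  size-∖-< S P {x} x∈S x∈P = begin-strict
    size (S ∖ P)                  <⟨ m<n+m (size (S ∖ P)) (≤-trans (≤-reflexive (sym x∈S∩P)) (term≤sum _ x)) ⟩
    size (S ∩ P) + size (S ∖ P)   ≡⟨ size-split S P ⟨
    size S                        ∎
    where
    open ≤-Reasoning
    x∈S∩P : ⟦ (S ∩ P) x ⟧ ≡ 1
    x∈S∩P rewrite to T-≡ x∈S | to T-≡ x∈P = refl

  module LongPaths (k : ℕ) where

    Sparse : VertexSet → Set
    Sparse S = degreeSum S ≤ k * size S

    LongPath : VertexSet → Set
    LongPath S = Σ (PathIn S) λ p → length (rest p) ≡ suc k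

    SparseOrLongPath : VertexSet → Set
    SparseOrLongPath S = Sparse S ⊎ LongPath S

    LongPath-⊆ : ∀ {S S′} → S ⊆ S′ → LongPath S → LongPath S′
    LongPath-⊆ S⊆S′ (p , len) = PathIn-⊆ S⊆S′ p , len

    remove-low-degree : ∀ S x → T (S x) → 2 * deg S x ≤ k →
                        SparseOrLongPath (S ─ x) → SparseOrLongPath S
    remove-low-degree S x _ _ (inj₂ long) = inj₂ (LongPath-⊆ (∖-⊆ S ｛ x ｝) long)
    remove-low-degree S x x∈S low (inj₁ sparse) = inj₁ (begin
      degreeSum S                        ≤⟨ degreeSum-─ S x ⟩
      degreeSum (S ─ x) + 2 * deg S x    ≤⟨ +-mono-≤ sparse low ⟩
      k * size (S ─ x) + k               ≡⟨ trans (+-comm _ k) (sym (*-suc k _)) ⟩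
      k * suc (size (S ─ x))             ≡⟨ cong (k *_) (size-─ S x x∈S) ⟨
      k * size S                         ∎)
      where open ≤-Reasoning

    remove-component : ∀ S ys → length ys ≤ suc k → Separated S ⟨ ys ⟩ →
                       SparseOrLongPath (S ∖ ⟨ ys ⟩) → SparseOrLongPath S
    remove-component S ys _ _ (inj₂ long) = inj₂ (LongPath-⊆ (∖-⊆ S ⟨ ys ⟩) long)
    remove-component S ys len≤ sep (inj₁ sparse) = inj₁ (begin
      degreeSum S                                 ≡⟨ degreeSum-separated S ⟨ ys ⟩ sep ⟩
      degreeSum (S ∩ ⟨ ys ⟩) + degreeSum (S ∖ ⟨ ys ⟩) ≤⟨ +-mono-≤ (degreeSum-≤ (S ∩ ⟨ ys ⟩) deg≤k) sparse ⟩
      k * size (S ∩ ⟨ ys ⟩) + k * size (S ∖ ⟨ ys ⟩) ≡⟨ *-distribˡ-+ k _ _ ⟨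
      k * (size (S ∩ ⟨ ys ⟩) + size (S ∖ ⟨ ys ⟩))   ≡⟨ cong (k *_) (size-split S ⟨ ys ⟩) ⟨
      k * size S                                  ∎)
      where
      open ≤-Reasoning
      -- every vertex of G[S ∩ ys] has its neighbours among the other |ys| - 1 ≤ k vertices
      deg≤k : ∀ u → T ((S ∩ ⟨ ys ⟩) u) → deg (S ∩ ⟨ ys ⟩) u ≤ k
      deg≤k u u∈ = ≤-pred (begin-strict
        deg (S ∩ ⟨ ys ⟩) u   ≤⟨ deg≤degIn (S ∩ ⟨ ys ⟩) u ys (λ w w∈ _ → ∈⟨⟩⇒∈ (proj₂ (to T-∧ w∈))) ⟩
        degIn u ys           <⟨ sumOver-<-length ys (λ v → ⟦⟧≤1 (adj G u v))
                                  (∈⟨⟩⇒∈ (proj₂ (to T-∧ u∈))) (cong ⟦_⟧ (proj₂ simple u)) ⟩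
        length ys            ≤⟨ len≤ ⟩
        suc k                ∎)

    module InductionStep (S : VertexSet) (smaller : ∀ S′ → size S′ < size S → SparseOrLongPath S′) where

      remove-endpoint : ∀ x → T (S x) → 2 * deg S x ≤ k → SparseOrLongPath S
      remove-endpoint x x∈S low =
        remove-low-degree S x x∈S low (smaller (S ─ x) (≤-reflexive (sym (size-─ S x x∈S))))

      both-ends-closed : (p : PathIn S) → length (rest p) ≤ k →
                    NeighboursIn S (start p) (vertices p) → NeighboursIn S (end p) (vertices p) →
                    Longer p ⊎ SparseOrLongPath S
      both-ends-closed p len≤k start-closed end-closed with suc k ≤? deg S (start p) + deg S (end p)
      ... | no few with summand-≤-half (deg S (start p)) (deg S (end p)) (≤-pred (≰⇒> few))
      ...   | inj₁ low = inj₂ (remove-endpoint (start p) (All.head (inside p)) low)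
      ...   | inj₂ low =
        inj₂ (remove-endpoint (end p) (All.lookup (inside p) (lastOf-∈ (start p) (rest p))) low)
      both-ends-closed p len≤k start-closed end-closed | yes many
        with any? (λ w → T? (S w) ×-dec ¬? (w ∈? vertices p) ×-dec
                           Any.any? (λ z → T? (adj G z w)) (vertices p))
      ... | yes (w , w∈S , w∉p , touches) with find touches
      ...   | z , z∈p , z~w = inj₁ (extend-via-cycle p ore w∈S w∉p z∈p z~w)
        where
        ore : length (rest p) < degIn (start p) (rest p) + degIn (end p) (vertices p)
        ore = <-≤-trans (s≤s len≤k) (≤-trans many (ore-bound p start-closed end-closed))
      both-ends-closed p len≤k start-closed end-closed | yes many | no isolated =
        inj₂ (remove-component S (vertices p) (s≤s len≤k) separated
               (smaller (S ∖ ⟨ vertices p ⟩) (size-∖-< S ⟨ vertices p ⟩ (All.head (inside p)) start∈p)))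
        where
        start∈p : T (⟨ vertices p ⟩ (start p))
        start∈p = ∈⇒∈⟨⟩ {start p} {vertices p} (here refl)
        separated : Separated S ⟨ vertices p ⟩
        separated u v u∈ v∈ u~v =
          isolated (v , proj₁ (to T-∧ v∈) , ∉⟨⟩⇒∉ (proj₂ (to T-∧ v∈)) ,
                    Any.map (λ u≡z → subst (_~ v) u≡z u~v) (∈⟨⟩⇒∈ (proj₂ (to T-∧ u∈))))

      longer-or-settled : (p : PathIn S) → length (rest p) ≤ k → Longer p ⊎ SparseOrLongPath S
      longer-or-settled p len≤k with extend-or-closed p
      ... | inj₁ longer = inj₁ longer
      ... | inj₂ start-closed with extend-or-closed (reversePath p)
      ...   | inj₁ (p′ , len′) = inj₁ (p′ , trans len′ (cong suc (length-reversePath p)))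
      ...   | inj₂ end-closed = both-ends-closed p len≤k start-closed
                                  (λ w w∈S e~w → ∈-resp-↭ (vertices-reversePath p) (end-closed w w∈S e~w))

      grow : ∀ f (p : PathIn S) → f + length (rest p) ≡ suc k → SparseOrLongPath S
      grow zero p len = inj₂ (p , len)
      grow (suc f) p len with longer-or-settled p (≤-trans (m≤n+m _ f) (≤-reflexive (suc-injective len)))
      ... | inj₁ (p′ , len′) = grow f p′ (trans (cong (f +_) len′) (trans (+-suc f _) len))
      ... | inj₂ settled = settled

    sparse-or-longPath : ∀ S → SparseOrLongPath S
    sparse-or-longPath S = go S (On.wellFounded size <-wellFounded S)
      where
      go : ∀ S → Acc (_<_ on size) S → SparseOrLongPath S
      go S (acc smaller) with any? (λ v → T? (S v))
      ... | no empty = inj₁ (degreeSum-≤ S {k} (λ u u∈S → ⊥-elim (empty (u , u∈S))))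
      ... | yes (v , v∈S) = InductionStep.grow S (λ S′ lt → go S′ (smaller lt)) (suc k)
                              (path v [] [-] ([] ∷ []) (v∈S ∷ [])) (+-identityʳ (suc k))

    longPath : ∀ S → k * size S < degreeSum S → CopyIn S (Path (suc (suc k)))
    longPath S dense with sparse-or-longPath S
    ... | inj₁ sparse = ⊥-elim (<⇒≱ dense sparse)
    ... | inj₂ (p , len) = subst (λ m → CopyIn S (Path (suc m))) len (path⇒copy p)

  star : ∀ k S → k * size S < degreeSum S → CopyIn S (Star (suc (suc k)))
  star k S dense with any? (λ c → T? (S c) ×-dec (suc k ≤? deg S c))
  ... | no none =
    ⊥-elim (<⇒≱ dense (degreeSum-≤ S (λ u u∈S → ≤-pred (≰⇒> (λ many → none (u , u∈S , many))))))
  ... | yes (c , c∈S , many) with choose (λ v → S v ∧ adj G c v) (suc k) many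
  ...   | g , g-inj , g-nbr = copy f f-inj spokes f∈S
    where
    f : Fin (suc (suc k)) → Fin n
    f zero = c
    f (suc i) = g i
    c≢g : ∀ i → c ≢ g i
    c≢g i c≡gi = ~-irrefl c (subst (c ~_) (sym c≡gi) (proj₂ (to T-∧ (g-nbr i))))
    f-inj : Injective _≡_ _≡_ f
    f-inj {zero} {zero} _ = refl
    f-inj {zero} {suc j} eq = ⊥-elim (c≢g j eq)
    f-inj {suc i} {zero} eq = ⊥-elim (c≢g i (sym eq))
    f-inj {suc i} {suc j} eq = cong suc (g-inj eq)
    spokes : ∀ u v → T (adj (Star _) u v) → f u ~ f v
    spokes zero (suc j) _ = proj₂ (to T-∧ (g-nbr j))
    spokes (suc i) zero _ = ~-sym (proj₂ (to T-∧ (g-nbr i)))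
    f∈S : ∀ u → T (S (f u))
    f∈S zero = c∈S
    f∈S (suc i) = proj₁ (to T-∧ (g-nbr i))

  module Packing {m} (H : Graph (Fin m)) (k Δ : ℕ) (deg≤Δ : ∀ S x → deg S x ≤ Δ)
                 (dense⇒copy : ∀ S → k * size S < degreeSum S → CopyIn S H) where

    -- removing a copy of H destroys at most m Δ edges
    cost : ℕ
    cost = 2 * (m * Δ)

    degreeSum-remove-copy : ∀ S (g : Fin m → Fin n) →
                            degreeSum S ≤ degreeSum (S ∖ ⟨ List.tabulate g ⟩) + cost
    degreeSum-remove-copy S g = ≤-trans (degreeSum-∖ S ⟨ image ⟩)
      (+-monoʳ-≤ (degreeSum (S ∖ ⟨ image ⟩)) (*-monoʳ-≤ 2 (begin
        degreeSumOn S ⟨ image ⟩   ≤⟨ degreeSumOn-≤ S ⟨ image ⟩ image (λ v → ∈⟨⟩⇒∈) ⟩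
        sumOver image (deg S)     ≤⟨ sumOver-≤ image (deg≤Δ S) ⟩
        length image * Δ          ≡⟨ cong (_* Δ) (length-tabulate g) ⟩
        m * Δ                     ∎)))
      where
      open ≤-Reasoning
      image = List.tabulate g

    add-copy : ∀ {r S} (c : CopyIn S H) → CopyIn (S ∖ ⟨ List.tabulate (CopyIn.embed c) ⟩) (r · H) →
               CopyIn S (suc r · H)
    add-copy {r} {S} (copy g g-inj g-edges g∈S) (copy F F-inj F-edges F∈S′) =
      copy F′ F′-inj F′-edges F′∈S
      where
      F∉g : ∀ x u → F x ≢ g u
      F∉g x u Fx≡gu = ∉⟨⟩⇒∉ (proj₂ (to T-∧ (F∈S′ x)))
                              (subst (_∈ List.tabulate g) (sym Fx≡gu) (∈-tabulate⁺ u))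
      F′ : Fin (suc r) × Fin m → Fin n
      F′ (zero , u) = g u
      F′ (suc a , u) = F (a , u)
      F′-inj : Injective _≡_ _≡_ F′
      F′-inj {zero , u} {zero , v} eq = cong (zero ,_) (g-inj eq)
      F′-inj {zero , u} {suc b , v} eq = ⊥-elim (F∉g (b , v) u (sym eq))
      F′-inj {suc a , u} {zero , v} eq = ⊥-elim (F∉g (a , u) v eq)
      F′-inj {suc a , u} {suc b , v} eq with F-inj eq
      ... | refl = refl
      F′-edges : ∀ x y → T (adj (suc r · H) x y) → F′ x ~ F′ y
      F′-edges (zero , u) (zero , v) = g-edges u v
      F′-edges (suc a , u) (suc b , v) = F-edges (a , u) (b , v)
      F′∈S : ∀ x → T (S (F′ x))
      F′∈S (zero , u) = g∈S u
      F′∈S (suc a , u) = ∖-⊆ S ⟨ List.tabulate g ⟩ (F (a , u)) (F∈S′ (a , u))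

    packing : ∀ r S → k * size S + r * cost < degreeSum S → CopyIn S (r · H)
    packing zero S _ = copy (λ { (() , _) }) (λ { {() , _} }) (λ { (() , _) }) (λ { (() , _) })
    packing (suc r) S dense = add-copy c (packing r S′ dense′)
      where
      c = dense⇒copy S (≤-<-trans (m≤m+n _ _) dense)
      S′ = S ∖ ⟨ List.tabulate (CopyIn.embed c) ⟩
      dense′ : k * size S′ + r * cost < degreeSum S′
      dense′ = +-cancelʳ-< cost _ _ (begin-strict
        k * size S′ + r * cost + cost
          ≤⟨ +-monoˡ-≤ cost (+-monoˡ-≤ (r * cost) (*-monoʳ-≤ k (size-∖-≤ S _))) ⟩
        k * size S + r * cost + cost    ≡⟨ +-assoc (k * size S) _ _ ⟩
        k * size S + (r * cost + cost)  ≡⟨ cong (k * size S +_) (+-comm (r * cost) cost) ⟩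
        k * size S + suc r * cost       <⟨ dense ⟩
        degreeSum S                     ≤⟨ degreeSum-remove-copy S (CopyIn.embed c) ⟩
        degreeSum S′ + cost             ∎)
        where open ≤-Reasoning

  allVertices : VertexSet
  allVertices _ = true

  size-allVertices : size allVertices ≡ n
  size-allVertices = sum-ones n

  deg≤degree : ∀ S x → deg S x ≤ degree G x
  deg≤degree S x = ≤-trans (sum-mono-≤ (λ v → ⟦∧⟧≤ʳ (S v) (adj G x v)))
                           (≤-reflexive (sym (countTrue-map-tabulate (adj G x) id)))

  copy⇒contains : ∀ {S W} {H : Graph W} → CopyIn S H → Contains G H
  copy⇒contains (copy f f-inj f-edges _) = f , f-inj , f-edges

  twice-edges≤degreeSum : 2 * edges G ≤ degreeSum allVertices
  twice-edges≤degreeSum = begin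
    2 * edges G                                 ≡⟨ m+m≡2*m (edges G) ⟨
    edges G + edges G                           ≡⟨ cong₂ _+_ edges≡ (trans edges≡ (∑-comm forward)) ⟩
    sum (λ i → sum (forward i)) + sum (λ i → sum (λ j → forward j i))
      ≡⟨ sym (trans (sum-cong-≗ (λ i → ∑-distrib-+ (forward i) (λ j → forward j i)))
                    (∑-distrib-+ (λ i → sum (forward i)) (λ i → sum (λ j → forward j i)))) ⟩
    sum (λ i → sum (λ j → forward i j + forward j i))
      ≤⟨ sum-mono-≤ (λ i → sum-mono-≤ (λ j → pointwise i j)) ⟩
    degreeSum allVertices                       ∎
    where
    open ≤-Reasoning
    forwardᵇ : Fin n → Fin n → Bool
    forwardᵇ i j = (toℕ i <ᵇ toℕ j) ∧ adj G i j
    forward : Fin n → Fin n → ℕ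
    forward i j = ⟦ forwardᵇ i j ⟧
    edges≡ : edges G ≡ sum (λ i → sum (forward i))
    edges≡ = trans (countTrue-concatMap-tabulate (λ i → List.map (forwardᵇ i) (List.allFin n)) id)
                   (sum-cong-≗ λ i → countTrue-map-tabulate (forwardᵇ i) id)
    pointwise : ∀ i j → forward i j + forward j i ≤ ⟦ adj G i j ⟧
    pointwise i j rewrite proj₁ simple j i = <ᵇ-∧-antisym (toℕ i) (toℕ j) (adj G i j)

disjoint-copies : ∀ {n} (G : Graph (Fin n)) → IsSimple G → ∀ k′ Δ s → (∀ v → degree G v ≤ Δ) →
  k′ * n + s * (2 * ((k′ + 2) * Δ)) < 2 * edges G →
  Contains G (s · Path (k′ + 2)) × Contains G (s · Star (k′ + 2))
disjoint-copies {n} G simple k′ Δ s Δ-bound surplus =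
  copy⇒contains (Paths.packing s allVertices dense) , copy⇒contains (Stars.packing s allVertices dense)
  where
  open InducedSubgraphs G simple
  deg≤Δ : ∀ S x → deg S x ≤ Δ
  deg≤Δ S x = ≤-trans (deg≤degree S x) (Δ-bound x)
  module Paths = Packing (Path (k′ + 2)) k′ Δ deg≤Δ
    (λ S dense → subst (λ m → CopyIn S (Path m)) (+-comm 2 k′) (LongPaths.longPath k′ S dense))
  module Stars = Packing (Star (k′ + 2)) k′ Δ deg≤Δ
    (λ S dense → subst (λ m → CopyIn S (Star m)) (+-comm 2 k′) (star k′ S dense))
  dense : k′ * size allVertices + s * (2 * ((k′ + 2) * Δ)) < degreeSum allVertices
  dense = subst (λ m → k′ * m + s * (2 * ((k′ + 2) * Δ)) < degreeSum allVertices) (sym size-allVertices)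
                (<-≤-trans surplus twice-edges≤degreeSum)

surplus : ∀ a n c q p e → c * q < n → 1 ≤ p → e * q ≡ a * n * q + p * n → a * n + c < e
surplus a n c q p e cq<n p≥1 eq = *-cancelʳ-< q _ _ (begin-strict
  (a * n + c) * q      ≡⟨ *-distribʳ-+ q (a * n) c ⟩
  a * n * q + c * q    <⟨ +-monoʳ-< (a * n * q) (<-≤-trans cq<n n≤pn) ⟩
  a * n * q + p * n    ≡⟨ eq ⟨
  e * q                ∎)
  where
  open ≤-Reasoning
  n≤pn : n ≤ p * n
  n≤pn = ≤-trans (≤-reflexive (sym (*-identityˡ n))) (*-monoˡ-≤ n p≥1)

-- ε = p / q, so e(G) = (k'n + εn)/2 reads 2·e(G)·q = k'·n·q + p·n.
lemma3p3 : (k k' s p q : ℕ) → k' < k → 1 ≤ s → 1 ≤ p → 1 ≤ q →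
  ∃[ n₀ ] ((n : ℕ) → n₀ ≤ n → (G : Graph (Fin n)) → IsSimple G →
    ((v : Fin n) → degree G v ≤ k ∸ 1) →
    2 * edges G * q ≡ k' * n * q + p * n →
    Contains G (s · Path (k' + 2)) × Contains G (s · Star (k' + 2)))
lemma3p3 k k′ s p q _ _ p≥1 _ = suc (s * cost * q) , λ n n₀≤n G simple Δ-bound edge-count →
  disjoint-copies G simple k′ (k ∸ 1) s Δ-bound
    (surplus k′ n (s * cost) q p (2 * edges G) n₀≤n p≥1 edge-count)
  where
  cost : ℕ
  cost = 2 * ((k′ + 2) * (k ∸ 1))
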